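{- Let $\pi_1,\dots,\pi_n$ be permutations of $\{1,\dots,m\}$ such that $LCS(\pi_i,\pi_j)\le r$ for all $i\ne j$. If $m>(n-1)r$, then in every schedule none of the $\pi_i$ is fully traversed.
   Context: $LCS(\pi,\sigma)$ is the length of the longest common subsequence of permutations $\pi$ and $\sigma$ considered cyclically, i.e. the maximum over all rotations of $\pi$ and of $\sigma$ of the length of the longest common subsequence of the rotated sequences. A schedule: players $P_1,\dots,P_n$, where $P_i$ walks cyclically along $\pi_i$ (viewed as a word of length $m$ over the chairs $\{1,\dots,m\}$) starting from a position chosen by the scheduler; a player is in conflict if another player occupies the same chair; in each round the scheduler selects a nonempty set of players currently in conflict and each selected player moves to the next letter of its permutation. A permutation $\pi_i$ is fully traversed if player $P_i$ makes $m$ moves along it. -}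

module Defs where

open import Data.Nat using (ℕ; zero; suc; _+_; _%_; _<_; _≤_)
open import Data.Nat.DivMod using (m%n<n)
open import Data.Fin using (Fin; toℕ; fromℕ<)
open import Data.Fin.Permutation using (Permutation′; _⟨$⟩ʳ_)
open import Data.Fin.Subset using (Subset; _∈_; _∉_; Nonempty)
open import Data.List using (List; map; allFin; drop; take; _++_; length)
open import Data.List.Relation.Binary.Sublist.Propositional using (_⊆_)
open import Data.Product using (∃; _×_; Σ)
open import Relation.Binary.PropositionalEquality using (_≡_; _≢_)
open import Relation.Binary.Construct.Closure.ReflexiveTransitive using (Star)

-- The word of a permutation π of {1..m}: π(1) π(2) ... π(m)  (chairs = Fin m).
word : ∀ {m} → Permutation′ m → List (Fin m)
word π = map (π ⟨$⟩ʳ_) (allFin _)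

rotate : ∀ {A : Set} → ℕ → List A → List A
rotate k xs = drop k xs ++ take k xs

-- Cyclic LCS(π,σ) ≤ r : every common subsequence of every pair of
-- rotations of the two words has length at most r (i.e. the maximum,
-- over all rotations, of the LCS length is at most r).
CyclicLCS≤ : ∀ {m} → Permutation′ m → Permutation′ m → ℕ → Set
CyclicLCS≤ {m} π σ r =
  (a b : Fin m) (w : List (Fin m)) →
  w ⊆ rotate (toℕ a) (word π) → w ⊆ rotate (toℕ b) (word σ) → length w ≤ r

-- Position reached after t moves, cyclically, starting at position s.
cyc : ∀ {m} → Fin m → ℕ → Fin m
cyc {suc k} s t = fromℕ< (m%n<n (toℕ s + t) (suc k))

-- A configuration records how many moves each player has made.
Config : ℕ → Set
Config n = Fin n → ℕ

module Game {n m : ℕ} (π : Fin n → Permutation′ m) (start : Fin n → Fin m) where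

  chair : Config n → Fin n → Fin m
  chair c i = π i ⟨$⟩ʳ cyc (start i) (c i)

  InConflict : Config n → Fin n → Set
  InConflict c i = ∃ λ j → j ≢ i × chair c j ≡ chair c i

  Round : Config n → Config n → Set
  Round c c' = Σ (Subset n) λ S →
    Nonempty S ×
    ((i : Fin n) → i ∈ S → InConflict c i) ×
    ((i : Fin n) → (i ∈ S → c' i ≡ suc (c i)) × (i ∉ S → c' i ≡ c i))

  -- configurations reachable by a (finite prefix of a) schedule
  Reachable : Config n → Set
  Reachable = Star Round (λ _ → 0)

-- Every move of a player P_i is forced by a conflict: some other player
-- P_j sits on the same chair, at some position p of its own walk.  Record such
-- a cause (j , p) for every move of P_i.  The positions recorded for a fixed
-- cause j never decrease, since P_j only moves forward, and they stay below m
-- as long as no player has completed a lap.  Suppose P_i completes its m-th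
-- move while all others have made fewer than m moves.  Its first m moves that
-- were caused by P_j visit chairs π_i(s_i + t) = π_j(s_j + p_t), where both t
-- and p_t strictly increase (a player never revisits a chair within a lap), so
-- they form a common subsequence of rotations of π_i and π_j: at most r moves.
-- Summing over the n - 1 possible causes gives m ≤ (n - 1) r, a contradiction.
module Submission where

open import Defs
open import Data.Nat using (ℕ; zero; suc; _+_; _∸_; _*_; _%_; _≤_; _<_; z≤n; z<s; s<s; s≤s⁻¹; _≟_; _≤?_; NonZero)
open import Data.Nat.Properties
open import Data.Nat.DivMod using (%-distribˡ-+; m<n⇒m%n≡m; m≤n⇒[n∸m]%m≡n%m; [m+n]%n≡m%n; m%n<n)
open import Data.Fin using (Fin; toℕ; punchIn)
open import Data.Fin.Properties using (toℕ-fromℕ<; toℕ-injective; toℕ<n; punchInᵢ≢i; punchIn-punchOut) renaming (_≟_ to _≟ᶠ_)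
open import Data.Fin.Permutation using (Permutation′; _⟨$⟩ʳ_)
open import Data.Fin.Subset.Properties using (_∈?_)
open import Data.List using (List; []; _∷_; _++_; map; filter; length; drop; take; applyUpTo; upTo; tabulate; allFin)
open import Data.List.Properties using (length-map; length-upTo; length-tabulate; map-++; drop-map; take-map; map-∘; map-cong-local; map-applyUpTo; map-tabulate; map-injective)
open import Data.List.Membership.Propositional using (_∈_)
open import Data.List.Membership.Propositional.Properties using (∈-upTo⁺; ∈-map⁺; ∈-map⁻; ∈-allFin)
open import Data.List.Relation.Unary.Any using (here; there)
open import Data.List.Relation.Unary.All as All using (All; []; _∷_)
open import Data.List.Relation.Unary.All.Properties using (all-upTo; all-filter) renaming (map⁺ to All-map⁺)
open import Data.List.Relation.Unary.AllPairs as AllPairs using (AllPairs; []; _∷_)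
import Data.List.Relation.Unary.AllPairs.Properties as AllPairs
open import Data.List.Relation.Binary.Sublist.Propositional using (_⊆_; []; _∷_; _∷ʳ_; minimum)
open import Data.List.Relation.Binary.Sublist.Propositional.Properties using (length-mono-≤; filter-⊆; filter⁺; All-resp-⊆)
import Data.List.Relation.Binary.Sublist.Propositional.Properties as Sublist
open import Data.Product using (_×_; _,_; proj₁; proj₂)
open import Data.Sum using (_⊎_; inj₁; inj₂)
open import Data.Empty using (⊥-elim)
open import Function using (id; _∘_)
open import Function.Bundles using (Injection)
open import Function.Properties.Inverse using (↔⇒↣)
open import Relation.Nullary using (yes; no; ¬_)
open import Relation.Unary using (Decidable)
open import Relation.Unary.Properties using (∁?)
open import Relation.Binary.Definitions using (DecidableEquality)
open import Relation.Binary.PropositionalEquality using (_≡_; _≢_; refl; sym; trans; cong; cong₂; subst; subst₂; module ≡-Reasoning)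
open import Relation.Binary.Construct.Closure.ReflexiveTransitive using (Star; ε; _◅_)

length-filter-split : ∀ {A : Set} {P : A → Set} (P? : Decidable P) (xs : List A) →
  length xs ≡ length (filter P? xs) + length (filter (∁? P?) xs)
length-filter-split P? [] = refl
length-filter-split P? (x ∷ xs) with P? x
... | yes _ = cong suc (length-filter-split P? xs)
... | no _ = trans (cong suc (length-filter-split P? xs)) (sym (+-suc _ _))

module Labelling {A L : Set} (_≟ˡ_ : DecidableEquality L) (label : A → L) where

  fibre : L → List A → List A
  fibre l = filter (λ x → label x ≟ˡ l)

  count-by-label : ∀ (b : ℕ) (ls : List L) (xs : List A) →
    All (λ x → label x ∈ ls) xs →
    (∀ l → l ∈ ls → length (fibre l xs) ≤ b) →
    length xs ≤ length ls * b
  count-by-label b [] [] _ _ = z≤n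
  count-by-label b [] (x ∷ xs) (() ∷ _) _
  count-by-label b (l ∷ ls) xs labelled bounded = begin
      length xs                          ≡⟨ length-filter-split (λ x → label x ≟ˡ l) xs ⟩
      length (fibre l xs) + length rest  ≤⟨ +-mono-≤ (bounded l (here refl))
                                              (count-by-label b ls rest labelled-rest bounded-rest) ⟩
      b + length ls * b                  ∎
    where
    open ≤-Reasoning
    rest : List A
    rest = filter (∁? (λ x → label x ≟ˡ l)) xs

    rest⊆xs : rest ⊆ xs
    rest⊆xs = filter-⊆ _ xs

    labelled-rest : All (λ x → label x ∈ ls) rest
    labelled-rest = All.zipWith other-label (All-resp-⊆ rest⊆xs labelled , all-filter _ xs)
      where
      other-label : ∀ {x} → label x ∈ l ∷ ls × ¬ label x ≡ l → label x ∈ ls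
      other-label (here eq , ≢l) = ⊥-elim (≢l eq)
      other-label (there ∈ls , _) = ∈ls

    bounded-rest : ∀ l′ → l′ ∈ ls → length (fibre l′ rest) ≤ b
    bounded-rest l′ l′∈ls = ≤-trans (length-mono-≤ (filter⁺ _ _ (λ { refl p → p }) rest⊆xs))
                                    (bounded l′ (there l′∈ls))

others : ∀ {n} → Fin n → List (Fin n)
others {suc n} i = map (punchIn i) (allFin n)

length-others : ∀ {n} (i : Fin n) → length (others i) ≡ n ∸ 1
length-others {suc n} i = trans (length-map (punchIn i) (allFin n)) (length-tabulate id)

∈-others : ∀ {n} {i j : Fin n} → j ≢ i → j ∈ others i
∈-others {suc n} {i} {j} j≢i =
  subst (_∈ others i) (punchIn-punchOut (j≢i ∘ sym)) (∈-map⁺ (punchIn i) (∈-allFin _))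

∈-others⁻ : ∀ {n} {i j : Fin n} → j ∈ others i → j ≢ i
∈-others⁻ {suc n} {i} j∈ with ∈-map⁻ (punchIn i) j∈
... | x , _ , refl = punchInᵢ≢i i x

drop-below : ∀ {x : ℕ} {xs qs} → All (x <_) qs → All (_∈ x ∷ xs) qs → All (_∈ xs) qs
drop-below x<qs qs∈ = All.zipWith tail (x<qs , qs∈)
  where
  tail : ∀ {x xs q} → x < q × q ∈ x ∷ xs → q ∈ xs
  tail (x<q , here refl) = ⊥-elim (<-irrefl refl x<q)
  tail (_ , there q∈xs) = q∈xs

sorted-⊆ : ∀ {xs ps : List ℕ} → AllPairs _<_ xs → AllPairs _<_ ps → All (_∈ xs) ps → ps ⊆ xs
sorted-⊆ {[]} _ _ [] = []
sorted-⊆ {x ∷ xs} {[]} _ _ [] = minimum (x ∷ xs)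
sorted-⊆ {x ∷ xs} (_ ∷ xs↑) (p< ∷ ps↑) (here refl ∷ ps∈) =
  refl ∷ sorted-⊆ xs↑ ps↑ (drop-below p< ps∈)
sorted-⊆ {x ∷ xs} (x< ∷ xs↑) (p< ∷ ps↑) (there p∈xs ∷ ps∈) =
  x ∷ʳ sorted-⊆ xs↑ (p< ∷ ps↑) (p∈xs ∷ drop-below (All.map (<-trans x<p) p<) ps∈)
  where x<p = All.lookup x< p∈xs

map-increasing : ∀ {Q : ℕ → Set} (f : ℕ → ℕ) {ts} →
  (∀ {t t′} → Q t → Q t′ → t < t′ → f t < f t′) →
  All Q ts → AllPairs _<_ ts → AllPairs _<_ (map f ts)
map-increasing f mono [] [] = []
map-increasing f mono (q ∷ qs) (t< ∷ ts↑) =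
  All-map⁺ (All.zipWith (λ (q′ , lt) → mono q q′ lt) (qs , t<)) ∷ map-increasing f mono qs ts↑

upTo-increasing : ∀ m → AllPairs _<_ (upTo m)
upTo-increasing m = AllPairs.applyUpTo⁺₁ id m (λ lt _ → lt)

rotate-map : ∀ {A B : Set} (f : A → B) k xs → rotate k (map f xs) ≡ map f (rotate k xs)
rotate-map f k xs = trans (cong₂ _++_ (drop-map k xs) (take-map k xs)) (sym (map-++ f (drop k xs) (take k xs)))

rotate-++ : ∀ {A : Set} (xs ys : List A) {k} → length xs ≡ k → rotate k (xs ++ ys) ≡ ys ++ xs
rotate-++ xs ys refl = cong₂ _++_ (drop-prefix xs) (take-prefix xs)
  where
  drop-prefix : ∀ xs → drop (length xs) (xs ++ ys) ≡ ys
  drop-prefix [] = refl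
  drop-prefix (x ∷ xs) = drop-prefix xs
  take-prefix : ∀ xs → take (length xs) (xs ++ ys) ≡ xs
  take-prefix [] = refl
  take-prefix (x ∷ xs) = cong (x ∷_) (take-prefix xs)

applyUpTo-++ : ∀ {A : Set} (f : ℕ → A) a b → applyUpTo f (a + b) ≡ applyUpTo f a ++ applyUpTo (λ t → f (a + t)) b
applyUpTo-++ f zero b = refl
applyUpTo-++ f (suc a) b = cong (f 0 ∷_) (applyUpTo-++ (f ∘ suc) a b)

applyUpTo-cong : ∀ {A : Set} {f g : ℕ → A} n → (∀ {t} → t < n → f t ≡ g t) → applyUpTo f n ≡ applyUpTo g n
applyUpTo-cong zero _ = refl
applyUpTo-cong (suc n) eq = cong₂ _∷_ (eq z<s) (applyUpTo-cong n (eq ∘ s<s))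

tabulate-toℕ : ∀ {A : Set} n (f : ℕ → A) → tabulate (λ (i : Fin n) → f (toℕ i)) ≡ applyUpTo f n
tabulate-toℕ zero f = refl
tabulate-toℕ (suc n) f = cong (f 0 ∷_) (tabulate-toℕ n (f ∘ suc))

toℕ-cyc : ∀ {k} (a : Fin (suc k)) t → toℕ (cyc a t) ≡ (toℕ a + t) % suc k
toℕ-cyc {k} a t = toℕ-fromℕ< (m%n<n (toℕ a + t) (suc k))

residue-shift : ∀ m .{{_ : NonZero m}} u {k} → 0 < k → k < m → u < m → (u + k) % m ≢ u
residue-shift m u {k} 0<k k<m u<m eq with m ≤? u + k
... | no u+k≱m = <⇒≢ 0<k (sym (+-cancelˡ-≡ u k 0 no-wrap))
  where
  no-wrap : u + k ≡ u + 0
  no-wrap = trans (sym (m<n⇒m%n≡m (≰⇒> u+k≱m))) (trans eq (sym (+-identityʳ u)))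
... | yes m≤u+k = <⇒≢ k<m (+-cancelˡ-≡ u k m wrapped)
  where
  below : u + k ∸ m < m
  below = subst (u + k ∸ m <_) (m+n∸n≡m m m) (∸-monoˡ-< (+-mono-< u<m k<m) m≤u+k)
  wrapped : u + k ≡ u + m
  wrapped = begin
    u + k            ≡⟨ sym (m∸n+n≡m m≤u+k) ⟩
    u + k ∸ m + m    ≡⟨ cong (_+ m) (trans (sym (m<n⇒m%n≡m below)) (trans (m≤n⇒[n∸m]%m≡n%m m≤u+k) eq)) ⟩
    u + m            ∎
    where open ≡-Reasoning

%-shift-≢ : ∀ m .{{_ : NonZero m}} x {k} → 0 < k → k < m → (x + k) % m ≢ x % m
%-shift-≢ m x {k} 0<k k<m eq = residue-shift m (x % m) 0<k k<m (m%n<n x m) (trans (sym reduce) eq)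
  where
  reduce : (x + k) % m ≡ (x % m + k) % m
  reduce = trans (%-distribˡ-+ x k m) (cong (λ z → (x % m + z) % m) (m<n⇒m%n≡m k<m))

cyc-injective : ∀ {m} (a : Fin m) {t t′} → t < t′ → t′ < m → cyc a t ≢ cyc a t′
cyc-injective {suc k} a {t} {t′} t<t′ t′<m eq =
  %-shift-≢ (suc k) (toℕ a + t) (m<n⇒0<n∸m t<t′) (≤-<-trans (m∸n≤m t′ t) t′<m) shifted
  where
  shifted : (toℕ a + t + (t′ ∸ t)) % suc k ≡ (toℕ a + t) % suc k
  shifted = begin
    (toℕ a + t + (t′ ∸ t)) % suc k ≡⟨ cong (_% suc k) (trans (+-assoc (toℕ a) t _) (cong (toℕ a +_) (m+[n∸m]≡n (<⇒≤ t<t′)))) ⟩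
    (toℕ a + t′) % suc k           ≡⟨ sym (toℕ-cyc a t′) ⟩
    toℕ (cyc a t′)                 ≡⟨ cong toℕ (sym eq) ⟩
    toℕ (cyc a t)                  ≡⟨ toℕ-cyc a t ⟩
    (toℕ a + t) % suc k            ∎
    where open ≡-Reasoning

rotate-allFin : ∀ {m} (a : Fin m) → rotate (toℕ a) (allFin m) ≡ map (cyc a) (upTo m)
rotate-allFin {suc k} a = map-injective toℕ-injective (trans split-rotation (sym split-walk))
  where
  open ≡-Reasoning
  A = toℕ a
  B = suc k ∸ A
  A≤m : A ≤ suc k
  A≤m = <⇒≤ (toℕ<n a)

  split-rotation : map toℕ (rotate A (allFin (suc k))) ≡ applyUpTo (A +_) B ++ upTo A
  split-rotation = begin
    map toℕ (rotate A (allFin (suc k)))      ≡⟨ sym (rotate-map toℕ A (allFin (suc k))) ⟩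
    rotate A (map toℕ (allFin (suc k)))      ≡⟨ cong (rotate A) (trans (map-tabulate id toℕ) (tabulate-toℕ (suc k) id)) ⟩
    rotate A (upTo (suc k))                  ≡⟨ cong (rotate A ∘ upTo) (sym (m+[n∸m]≡n A≤m)) ⟩
    rotate A (upTo (A + B))                  ≡⟨ cong (rotate A) (applyUpTo-++ id A B) ⟩
    rotate A (upTo A ++ applyUpTo (A +_) B)  ≡⟨ rotate-++ (upTo A) _ (length-upTo A) ⟩
    applyUpTo (A +_) B ++ upTo A             ∎

  no-wrap : ∀ {t} → t < B → toℕ (cyc a t) ≡ A + t
  no-wrap {t} t<B = trans (toℕ-cyc a t) (m<n⇒m%n≡m (subst (A + t <_) (m+[n∸m]≡n A≤m) (+-monoʳ-< A t<B)))

  wrap : ∀ {s} → s < A → toℕ (cyc a (B + s)) ≡ s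
  wrap {s} s<A = begin
    toℕ (cyc a (B + s))     ≡⟨ toℕ-cyc a (B + s) ⟩
    (A + (B + s)) % suc k   ≡⟨ cong (_% suc k) (trans (sym (+-assoc A B s)) (trans (cong (_+ s) (m+[n∸m]≡n A≤m)) (+-comm (suc k) s))) ⟩
    (s + suc k) % suc k     ≡⟨ [m+n]%n≡m%n s (suc k) ⟩
    s % suc k               ≡⟨ m<n⇒m%n≡m (<-trans s<A (toℕ<n a)) ⟩
    s                       ∎

  split-walk : map toℕ (map (cyc a) (upTo (suc k))) ≡ applyUpTo (A +_) B ++ upTo A
  split-walk = begin
    map toℕ (map (cyc a) (upTo (suc k)))  ≡⟨ sym (map-∘ (upTo (suc k))) ⟩
    map (toℕ ∘ cyc a) (upTo (suc k))      ≡⟨ map-applyUpTo id (toℕ ∘ cyc a) (suc k) ⟩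
    applyUpTo (toℕ ∘ cyc a) (suc k)       ≡⟨ cong (applyUpTo _) (sym (m∸n+n≡m A≤m)) ⟩
    applyUpTo (toℕ ∘ cyc a) (B + A)       ≡⟨ applyUpTo-++ (toℕ ∘ cyc a) B A ⟩
    applyUpTo (toℕ ∘ cyc a) B ++ applyUpTo (λ s → toℕ (cyc a (B + s))) A
                                          ≡⟨ cong₂ _++_ (applyUpTo-cong B no-wrap) (applyUpTo-cong A wrap) ⟩
    applyUpTo (A +_) B ++ upTo A          ∎

rotate-word : ∀ {m} (π : Permutation′ m) (a : Fin m) →
  rotate (toℕ a) (word π) ≡ map (λ t → π ⟨$⟩ʳ cyc a t) (upTo m)
rotate-word {m} π a = begin
  rotate (toℕ a) (map (π ⟨$⟩ʳ_) (allFin m))  ≡⟨ rotate-map (π ⟨$⟩ʳ_) (toℕ a) (allFin m) ⟩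
  map (π ⟨$⟩ʳ_) (rotate (toℕ a) (allFin m))  ≡⟨ cong (map (π ⟨$⟩ʳ_)) (rotate-allFin a) ⟩
  map (π ⟨$⟩ʳ_) (map (cyc a) (upTo m))       ≡⟨ sym (map-∘ (upTo m)) ⟩
  map (λ t → π ⟨$⟩ʳ cyc a t) (upTo m)        ∎
  where open ≡-Reasoning

module Walk {n m : ℕ} (π : Fin n → Permutation′ m) (start : Fin n → Fin m) where
  open Game π start

  chairAt : Fin n → ℕ → Fin m
  chairAt i t = π i ⟨$⟩ʳ cyc (start i) t

  chairAt-injective : ∀ i {t t′} → t < t′ → t′ < m → chairAt i t ≢ chairAt i t′
  chairAt-injective i t<t′ t′<m same =
    cyc-injective (start i) t<t′ t′<m (Injection.injective (↔⇒↣ (π i)) same)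

  record Caused (d : Config n) (i : Fin n) (k : ℕ) : Set where
    field
      cause         : ℕ → Fin n
      causePos      : ℕ → ℕ
      cause≢        : ∀ {t} → t < k → cause t ≢ i
      sameChair     : ∀ {t} → t < k → chairAt (cause t) (causePos t) ≡ chairAt i t
      causePos≤     : ∀ {t} → t < k → causePos t ≤ d (cause t)
      causePos-mono : ∀ {t t′} → t < t′ → t′ < k → cause t ≡ cause t′ → causePos t ≤ causePos t′

  caused-zero : ∀ {d i} → Caused d i 0
  caused-zero {i = i} = record
    { cause = λ _ → i ; causePos = λ _ → 0
    ; cause≢ = λ () ; sameChair = λ () ; causePos≤ = λ () ; causePos-mono = λ _ () }

  caused-weaken : ∀ {d d′ i k} → (∀ j → d j ≤ d′ j) → Caused d i k → Caused d′ i k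
  caused-weaken d≤d′ C = record
    { cause = cause ; causePos = causePos ; cause≢ = cause≢ ; sameChair = sameChair
    ; causePos≤ = λ t<k → ≤-trans (causePos≤ t<k) (d≤d′ _) ; causePos-mono = causePos-mono }
    where open Caused C

  -- A move of i at time k, forced by player j at its current position d j,
  -- extends the record.  Monotonicity holds because older positions of j are ≤ d j.
  caused-extend : ∀ {d i k j} → Caused d i k → j ≢ i → chairAt j (d j) ≡ chairAt i k → Caused d i (suc k)
  caused-extend {d} {i} {k} {j} C j≢i same = record
    { cause = cause′ ; causePos = causePos′ ; cause≢ = cause≢′ ; sameChair = sameChair′
    ; causePos≤ = causePos≤′ ; causePos-mono = causePos-mono′ }
    where
    open Caused C
    earlier : ∀ {t} → t < suc k → t ≢ k → t < k
    earlier t<1+k t≢k = ≤∧≢⇒< (s≤s⁻¹ t<1+k) t≢k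

    cause′ : ℕ → Fin n
    cause′ t with t ≟ k
    ... | yes _ = j
    ... | no _ = cause t

    causePos′ : ℕ → ℕ
    causePos′ t with t ≟ k
    ... | yes _ = d j
    ... | no _ = causePos t

    cause≢′ : ∀ {t} → t < suc k → cause′ t ≢ i
    cause≢′ {t} t<1+k with t ≟ k
    ... | yes _ = j≢i
    ... | no t≢k = cause≢ (earlier t<1+k t≢k)

    sameChair′ : ∀ {t} → t < suc k → chairAt (cause′ t) (causePos′ t) ≡ chairAt i t
    sameChair′ {t} t<1+k with t ≟ k
    ... | yes refl = same
    ... | no t≢k = sameChair (earlier t<1+k t≢k)

    causePos≤′ : ∀ {t} → t < suc k → causePos′ t ≤ d (cause′ t)
    causePos≤′ {t} t<1+k with t ≟ k
    ... | yes _ = ≤-refl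
    ... | no t≢k = causePos≤ (earlier t<1+k t≢k)

    causePos-mono′ : ∀ {t t′} → t < t′ → t′ < suc k → cause′ t ≡ cause′ t′ → causePos′ t ≤ causePos′ t′
    causePos-mono′ {t} {t′} t<t′ t′<1+k eq with t ≟ k | t′ ≟ k
    ... | yes refl | _ = ⊥-elim (<⇒≱ t<t′ (s≤s⁻¹ t′<1+k))
    ... | no t≢k | yes refl = subst (λ x → causePos t ≤ d x) eq (causePos≤ t<t′)
    ... | no t≢k | no t′≢k = causePos-mono t<t′ (earlier t′<1+k t′≢k) eq

  round-move : ∀ {c c′} → Round c c′ → ∀ i → (c′ i ≡ c i) ⊎ (c′ i ≡ suc (c i) × InConflict c i)
  round-move (S , _ , conflict , moves) i with i ∈? S
  ... | yes i∈S = inj₂ (proj₁ (moves i) i∈S , conflict i i∈S)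
  ... | no i∉S = inj₁ (proj₂ (moves i) i∉S)

  round-monotone : ∀ {c c′} → Round c c′ → ∀ i → c i ≤ c′ i
  round-monotone R i with round-move R i
  ... | inj₁ stay = ≤-reflexive (sym stay)
  ... | inj₂ (step , _) = subst (_ ≤_) (sym step) (n≤1+n _)

  caused-round : ∀ {c c′} → (∀ i → Caused c i (c i)) → Round c c′ → ∀ i → Caused c i (c′ i)
  caused-round H R i with round-move R i
  ... | inj₁ stay = subst (Caused _ i) (sym stay) (H i)
  ... | inj₂ (step , j , j≢i , same) = subst (Caused _ i) (sym step) (caused-extend (H i) j≢i same)

  module LapBound (r : ℕ) (lcs : (i j : Fin n) → i ≢ j → CyclicLCS≤ (π i) (π j) r)
                  {d : Config n} (d<m : ∀ j → d j < m)
                  {i : Fin n} {k : ℕ} (C : Caused d i k) (m≤k : m ≤ k) where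
    open Caused C
    open Labelling _≟ᶠ_ cause

    first-lap : ∀ {t} → t < m → t < k
    first-lap t<m = <-≤-trans t<m m≤k

    movesBy : Fin n → List ℕ
    movesBy j = fibre j (upTo m)

    movesBy-facts : ∀ j → All (λ t → t < m × cause t ≡ j) (movesBy j)
    movesBy-facts j = All.zip (All-resp-⊆ (filter-⊆ _ (upTo m)) (all-upTo m) , all-filter _ (upTo m))

    causePos-increasing : ∀ {t t′} → t < t′ → t′ < m → cause t ≡ cause t′ → causePos t < causePos t′
    causePos-increasing {t} {t′} t<t′ t′<m same-cause =
      ≤∧≢⇒< (causePos-mono t<t′ (first-lap t′<m) same-cause) distinct
      where
      open ≡-Reasoning
      distinct : causePos t ≢ causePos t′
      distinct same-pos = chairAt-injective i t<t′ t′<m (begin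
        chairAt i t                       ≡⟨ sym (sameChair (first-lap (<-trans t<t′ t′<m))) ⟩
        chairAt (cause t) (causePos t)    ≡⟨ cong₂ chairAt same-cause same-pos ⟩
        chairAt (cause t′) (causePos t′)  ≡⟨ sameChair (first-lap t′<m) ⟩
        chairAt i t′                      ∎)

    positions⊆lap : ∀ j → map causePos (movesBy j) ⊆ upTo m
    positions⊆lap j = sorted-⊆ (upTo-increasing m)
      (map-increasing causePos (λ (_ , c≡j) (t′<m , c′≡j) t<t′ → causePos-increasing t<t′ t′<m (trans c≡j (sym c′≡j)))
         (movesBy-facts j) (AllPairs.filter⁺ _ (upTo-increasing m)))
      (All-map⁺ (All.map (λ (t<m , _) → ∈-upTo⁺ (≤-<-trans (causePos≤ (first-lap t<m)) (d<m _))) (movesBy-facts j)))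

    -- The chairs of those moves are a common subsequence of rotations of π_i
    -- and π_j, so there are at most r of them.
    movesBy-bound : ∀ j → j ∈ others i → length (movesBy j) ≤ r
    movesBy-bound j j∈others = subst (_≤ r) (length-map (chairAt i) (movesBy j))
      (lcs i j (∈-others⁻ j∈others ∘ sym) (start i) (start j) chairs in-π-i in-π-j)
      where
      chairs : List (Fin m)
      chairs = map (chairAt i) (movesBy j)

      chairs-via-j : chairs ≡ map (chairAt j) (map causePos (movesBy j))
      chairs-via-j = trans (map-cong-local (All.map (λ {t} (t<m , c≡j) →
                             trans (sym (sameChair (first-lap t<m))) (cong (λ x → chairAt x (causePos t)) c≡j))
                           (movesBy-facts j)))
                         (map-∘ (movesBy j))

      in-π-i : chairs ⊆ rotate (toℕ (start i)) (word (π i))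
      in-π-i = subst (chairs ⊆_) (sym (rotate-word (π i) (start i))) (Sublist.map⁺ (chairAt i) (filter-⊆ _ (upTo m)))

      in-π-j : chairs ⊆ rotate (toℕ (start j)) (word (π j))
      in-π-j = subst₂ _⊆_ (sym chairs-via-j) (sym (rotate-word (π j) (start j))) (Sublist.map⁺ (chairAt j) (positions⊆lap j))

    lap-bound : m ≤ (n ∸ 1) * r
    lap-bound = begin
      m                      ≡⟨ sym (length-upTo m) ⟩
      length (upTo m)        ≤⟨ count-by-label r (others i) (upTo m) labelled movesBy-bound ⟩
      length (others i) * r  ≡⟨ cong (_* r) (length-others i) ⟩
      (n ∸ 1) * r            ∎
      where
      open ≤-Reasoning
      labelled : All (λ t → cause t ∈ others i) (upTo m)
      labelled = All.map (λ t<m → ∈-others (cause≢ (first-lap t<m))) (all-upTo m)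

  module Safety (r : ℕ) (lcs : (i j : Fin n) → i ≢ j → CyclicLCS≤ (π i) (π j) r)
                (m-large : (n ∸ 1) * r < m) where

    Safe : Config n → Set
    Safe c = (∀ i → Caused c i (c i)) × (∀ i → c i < m)

    safe-start : Safe (λ _ → 0)
    safe-start = (λ _ → caused-zero) , (λ _ → ≤-<-trans z≤n m-large)

    safe-round : ∀ {c c′} → Round c c′ → Safe c → Safe c′
    safe-round {c} {c′} R (recorded , c<m) = (λ i → caused-weaken (round-monotone R) (recorded′ i)) , c′<m
      where
      recorded′ : ∀ i → Caused c i (c′ i)
      recorded′ = caused-round recorded R
      c′<m : ∀ i → c′ i < m
      c′<m i with m ≤? c′ i
      ... | yes m≤c′ = ⊥-elim (<⇒≱ m-large (LapBound.lap-bound r lcs c<m (recorded′ i) m≤c′))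
      ... | no m≰c′ = ≰⇒> m≰c′

    safe-along : ∀ {c₀ c} → Star Round c₀ c → Safe c₀ → Safe c
    safe-along ε safe = safe
    safe-along (R ◅ Rs) safe = safe-along Rs (safe-round R safe)

proposition10 : (n m r : ℕ) (π : Fin n → Permutation′ m) →
    ((i j : Fin n) → i ≢ j → CyclicLCS≤ (π i) (π j) r) →
    (n ∸ 1) * r < m →
    (start : Fin n → Fin m) (c : Config n) →
    Game.Reachable π start c →
    (i : Fin n) → c i < m
proposition10 n m r π lcs m-large start c reachable = proj₂ (safe-along reachable safe-start)
  where open Walk.Safety π start r lcs m-large
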